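{- Define numbers $C_n$ ($n\ge1$) by $$C_n=\frac12\sum_{\substack{k+j=n\\ k\ge1,\ j\ge0}}\frac{E_j(1)}{j!}\,\frac{B(k)}{k!\,k},$$ equivalently by the expansion $\frac{e^z}{e^z+1}\log\big(\frac{e^z-1}{z}\big)=\sum_{n\ge1}C_nz^n$ near $z=0$. Then for $n=1,2,\dots$, $$(2n)!\,C_{2n}=\Big(\frac{1}{4n}+2^{2n-1}-\frac12\Big)B_{2n}.$$
   Context: The Euler polynomials $E_n(x)$ are defined by $\frac{2e^{xt}}{e^t+1}=\sum_{n\ge0}E_n(x)\frac{t^n}{n!}$ ($|t|<\pi$). The Bernoulli numbers $B_n$ are defined by $\frac{t}{e^t-1}=\sum_{n\ge0}B_n\frac{t^n}{n!}$; $B(n)=B_n$ for $n\ne1$ and $B(1)=-B_1=\frac12$, so that $\frac{ze^z}{e^z-1}=\sum_{n\ge0}\frac{B(n)}{n!}z^n$. -}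

module Defs where

open import Data.Nat as ℕ using (ℕ; zero; suc)
open import Data.Nat.Combinatorics using (_C_)
open import Data.Nat.Properties using (_!≢0)
open import Data.Integer using (+_)
open import Data.Rational using (ℚ; _/_; _+_; _*_; _-_; 0ℚ; 1ℚ)
open import Data.List using (List; []; _∷_; _++_; foldr; zipWith; upTo; map)

sum : List ℚ → ℚ
sum = foldr _+_ 0ℚ

ℕ→ℚ : ℕ → ℚ
ℕ→ℚ n = (+ n) / 1

inv-suc : ℕ → ℚ
inv-suc n = (+ 1) / suc n

half : ℚ
half = (+ 1) / 2

infixr 8 _^q_
_^q_ : ℚ → ℕ → ℚ
x ^q zero = 1ℚ
x ^q suc n = x * (x ^q n)


δ0 : ℕ → ℚ
δ0 zero = 1ℚ
δ0 (suc _) = 0ℚ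

-- Bernoulli numbers, t/(e^t-1) = Σ B_n t^n/n!.
-- Comparing coefficients of t^(n+1)/(n+1)! in  t = (Σ B_k t^k/k!)(e^t - 1)
-- gives  Σ_{k=0}^{n} C(n+1,k) B_k = δ_{n,0}, i.e.
--   B_n = (δ_{n,0} - Σ_{k<n} C(n+1,k) B_k) / (n+1).

bern-next : ℕ → List ℚ → ℚ
bern-next n prev =
  (δ0 n - sum (zipWith (λ k b → ℕ→ℚ (suc n C k) * b) (upTo n) prev)) * inv-suc n

bern-list : ℕ → List ℚ
bern-list zero = []
bern-list (suc n) = bern-list n ++ (bern-next n (bern-list n) ∷ [])

Bern : ℕ → ℚ
Bern n = bern-next n (bern-list n)

-- B(n) = B_n for n ≠ 1, B(1) = -B_1 = 1/2
Bmod : ℕ → ℚ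
Bmod 1 = half
Bmod n = Bern n

-- Euler polynomials, 2e^{xt}/(e^t+1) = Σ E_n(x) t^n/n!.
-- Comparing coefficients of t^n/n! in  2e^{xt} = (Σ E_k(x) t^k/k!)(e^t + 1)
-- gives  2x^n = Σ_{k≤n} C(n,k) E_k(x) + E_n(x), i.e.
--   E_n(x) = x^n - (1/2) Σ_{k<n} C(n,k) E_k(x).

euler-next : ℚ → ℕ → List ℚ → ℚ
euler-next x n prev =
  (x ^q n) - half * sum (zipWith (λ k e → ℕ→ℚ (n C k) * e) (upTo n) prev)

euler-list : ℚ → ℕ → List ℚ
euler-list x zero = []
euler-list x (suc n) = euler-list x n ++ (euler-next x n (euler-list x n) ∷ [])

EulerPoly : ℕ → ℚ → ℚ
EulerPoly n x = euler-next x n (euler-list x n)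

-- C_n = 1/2 Σ_{k+j=n, k≥1, j≥0} E_j(1)/j! · B(k)/(k!·k)
-- summand indexed by k ∈ {1,…,n}, j = n - k

C-term : ℕ → ℕ → ℚ
C-term n k =
  (EulerPoly (n ℕ.∸ k) 1ℚ * ((+ 1) / ((n ℕ.∸ k) ℕ.!)))
    * (Bmod k * ((+ 1) / (k ℕ.!)) * inv-suc (k ℕ.∸ 1))
  where instance
    _ = (n ℕ.∸ k) !≢0
    _ = k !≢0

-- note: for k ≥ 1, inv-suc (k ∸ 1) = 1/k
C : ℕ → ℚ
C n = half * sum (map (λ i → C-term n (suc i)) (upTo n))

-- Work with exponential generating functions over ℚ. Writing B(t) = Σ B_n tⁿ/n!
-- and E(t) = Σ E_n(1) tⁿ/n!, the defining recurrences say B(t)(eᵗ − 1) = t and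
-- E(t)(eᵗ + 1) = 2eᵗ. Both eᵗ − 1 and eᵗ + 1 divide t, and t is not a zero divisor,
-- so either factor may be cancelled. Substituting −t then gives B(−t) = B(t) + t and
-- E(−t) + E(t) = 2, whence B_k = 0 for odd k ≥ 3 and E_j(1) = 0 for even j ≥ 2, and
-- substituting 2t gives t E(t) = 2(B(2t) − B(t)) + 2t. In C_{2n} the parity facts
-- kill every term except k = 1 and k = 2n, and the duplication formula turns the
-- first of these, 2n E_{2n−1}(1), into 2(2^{2n} − 1) B_{2n}.

{-# OPTIONS --safe #-}
module Submission where

open import Defs
open import Data.Nat as ℕ using (ℕ; zero; suc)
open import Data.Integer using (+_)
open import Data.Rational using (ℚ; _/_; _+_; _*_; _-_)
open import Relation.Binary.PropositionalEquality using (_≡_)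

open import Data.Rational using (-_; 0ℚ; 1ℚ; mkℚ)
open import Data.Rational.Properties
open import Data.Rational.Solver using (module +-*-Solver)
open import Data.Nat.Combinatorics
  using (nCn≡1; nC1≡n; nCk≡nC[n∸k]; k>n⇒nCk≡0; nCk+nC[k+1]≡[n+1]C[k+1]) renaming (_C_ to _choose_)
open import Data.Nat.Coprimality as Coprimality using (1-coprimeTo)
import Data.Nat.Properties as ℕP
import Data.Integer.Properties as ℤP
open import Data.List using (List; []; _∷_; _++_; map; upTo; zipWith)
import Data.List.Properties as ListP
open import Function using (_∘_; const)
open import Relation.Binary.PropositionalEquality
  using (refl; sym; trans; cong; cong₂; _≗_; _→-setoid_; module ≡-Reasoning)
import Relation.Binary.Reasoning.Setoid as SetoidReasoning

open +-*-Solver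

module ≗-Reasoning = SetoidReasoning (ℕ →-setoid ℚ)

ℕ→ℚ≡mkℚ : ∀ n → ℕ→ℚ n ≡ mkℚ (+ n) 0 (Coprimality.sym (1-coprimeTo n))
ℕ→ℚ≡mkℚ n = ↥p/↧p≡p (mkℚ (+ n) 0 (Coprimality.sym (1-coprimeTo n)))

ℕ→ℚ-homo-+ : ∀ a b → ℕ→ℚ (a ℕ.+ b) ≡ ℕ→ℚ a + ℕ→ℚ b
ℕ→ℚ-homo-+ a b rewrite ℕ→ℚ≡mkℚ a | ℕ→ℚ≡mkℚ b
  | ℤP.*-identityʳ (+ a) | ℤP.*-identityʳ (+ b) | sym (ℤP.pos-+ a b) = refl

ℕ→ℚ-homo-* : ∀ a b → ℕ→ℚ (a ℕ.* b) ≡ ℕ→ℚ a * ℕ→ℚ b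
ℕ→ℚ-homo-* a b rewrite ℕ→ℚ≡mkℚ a | ℕ→ℚ≡mkℚ b | sym (ℤP.pos-* a b) = refl

ℕ→ℚ-homo-^ : ∀ a n → ℕ→ℚ (a ℕ.^ n) ≡ ℕ→ℚ a ^q n
ℕ→ℚ-homo-^ a zero    = refl
ℕ→ℚ-homo-^ a (suc n) = trans (ℕ→ℚ-homo-* a (a ℕ.^ n)) (cong (ℕ→ℚ a *_) (ℕ→ℚ-homo-^ a n))

ℕ→ℚ-*-inverse : ∀ n .{{_ : ℕ.NonZero n}} → ℕ→ℚ n * ((+ 1) / n) ≡ 1ℚ
ℕ→ℚ-*-inverse (suc k)
  rewrite ℕ→ℚ≡mkℚ (suc k) | ↥p/↧p≡p (mkℚ (+ 1) k (1-coprimeTo (suc k)))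
  = *-inverseʳ (mkℚ (+ suc k) 0 (Coprimality.sym (1-coprimeTo (suc k))))

*-cancelˡ-ℕ→ℚ : ∀ n .{{_ : ℕ.NonZero n}} {x y} → ℕ→ℚ n * x ≡ ℕ→ℚ n * y → x ≡ y
*-cancelˡ-ℕ→ℚ n {x} {y} eq = trans (sym (undo x)) (trans (cong (((+ 1) / n) *_) eq) (undo y))
  where
  open ≡-Reasoning
  undo : ∀ z → ((+ 1) / n) * (ℕ→ℚ n * z) ≡ z
  undo z = begin
    ((+ 1) / n) * (ℕ→ℚ n * z)
      ≡⟨ solve 3 (λ i a z → i :* (a :* z) := (a :* i) :* z) refl ((+ 1) / n) (ℕ→ℚ n) z ⟩
    (ℕ→ℚ n * ((+ 1) / n)) * z ≡⟨ cong (_* z) (ℕ→ℚ-*-inverse n) ⟩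
    1ℚ * z                  ≡⟨ *-identityˡ z ⟩
    z                       ∎

x+x≡0⇒x≡0 : ∀ {x} → x + x ≡ 0ℚ → x ≡ 0ℚ
x+x≡0⇒x≡0 {x} x+x≡0 = begin
  x            ≡⟨ solve 1 (λ x → x := con half :* (x :+ x)) refl x ⟩
  half * (x + x) ≡⟨ cong (half *_) x+x≡0 ⟩
  half * 0ℚ    ≡⟨ *-zeroʳ half ⟩
  0ℚ           ∎
  where open ≡-Reasoning

1/[2*[1+n]]≡½*1/[1+n] : ∀ n d .{{_ : ℕ.NonZero d}} → d ≡ 2 ℕ.* suc n → (+ 1) / d ≡ half * inv-suc n
1/[2*[1+n]]≡½*1/[1+n] n d d≡2[1+n] = *-cancelˡ-ℕ→ℚ d (trans (ℕ→ℚ-*-inverse d) (sym (begin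
  ℕ→ℚ d * (half * inv-suc n)                 ≡⟨ cong (λ e → ℕ→ℚ e * (half * inv-suc n)) d≡2[1+n] ⟩
  ℕ→ℚ (2 ℕ.* suc n) * (half * inv-suc n)     ≡⟨ cong (_* (half * inv-suc n)) (ℕ→ℚ-homo-* 2 (suc n)) ⟩
  (ℕ→ℚ 2 * ℕ→ℚ (suc n)) * (half * inv-suc n)
    ≡⟨ solve 4 (λ t a h i → (t :* a) :* (h :* i) := (t :* h) :* (a :* i)) refl (ℕ→ℚ 2) (ℕ→ℚ (suc n)) half (inv-suc n) ⟩
  (ℕ→ℚ 2 * half) * (ℕ→ℚ (suc n) * inv-suc n) ≡⟨ cong ((ℕ→ℚ 2 * half) *_) (ℕ→ℚ-*-inverse (suc n)) ⟩
  (ℕ→ℚ 2 * half) * 1ℚ                         ≡⟨⟩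
  1ℚ                                          ∎)))
  where open ≡-Reasoning

-1^[n+n]≡1 : ∀ n → (- 1ℚ) ^q (n ℕ.+ n) ≡ 1ℚ
-1^[n+n]≡1 zero    = refl
-1^[n+n]≡1 (suc n) rewrite ℕP.+-suc n n | -1^[n+n]≡1 n = refl

∑ : ℕ → (ℕ → ℚ) → ℚ
∑ zero    f = 0ℚ
∑ (suc n) f = ∑ n f + f n

∑-cong : ∀ n {f g} → f ≗ g → ∑ n f ≡ ∑ n g
∑-cong zero    f≗g = refl
∑-cong (suc n) f≗g = cong₂ _+_ (∑-cong n f≗g) (f≗g n)

∑-distrib-+ : ∀ n f g → ∑ n (λ k → f k + g k) ≡ ∑ n f + ∑ n g
∑-distrib-+ zero    f g = sym (+-identityˡ 0ℚ)
∑-distrib-+ (suc n) f g = trans (cong (_+ (f n + g n)) (∑-distrib-+ n f g))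
  (solve 4 (λ a b c d → (a :+ b) :+ (c :+ d) := (a :+ c) :+ (b :+ d)) refl (∑ n f) (∑ n g) (f n) (g n))

∑-split-first : ∀ n f → ∑ (suc n) f ≡ f 0 + ∑ n (f ∘ suc)
∑-split-first zero    f = trans (+-identityˡ (f 0)) (sym (+-identityʳ (f 0)))
∑-split-first (suc n) f = trans (cong (_+ f (suc n)) (∑-split-first n f)) (+-assoc (f 0) _ _)

∑-pairs : ∀ m f → ∑ (m ℕ.+ m) f ≡ ∑ m (λ l → f (l ℕ.+ l) + f (suc (l ℕ.+ l)))
∑-pairs zero    f = refl
∑-pairs (suc m) f rewrite ℕP.+-suc m m =
  trans (+-assoc (∑ (m ℕ.+ m) f) _ _) (cong (_+ (f (m ℕ.+ m) + f (suc (m ℕ.+ m)))) (∑-pairs m f))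

∑-zero : ∀ n f → (∀ k → k ℕ.< n → f k ≡ 0ℚ) → ∑ n f ≡ 0ℚ
∑-zero zero    f f≡0 = refl
∑-zero (suc n) f f≡0 = cong₂ _+_ (∑-zero n f (λ k k<n → f≡0 k (ℕP.m<n⇒m<1+n k<n))) (f≡0 n ℕP.≤-refl)

sum-map-upTo : ∀ n f → sum (map f (upTo n)) ≡ ∑ n f
sum-map-upTo zero    f = refl
sum-map-upTo (suc n) f = begin
  sum (map f (upTo (suc n)))          ≡⟨ cong (sum ∘ map f) (sym (ListP.upTo-∷ʳ n)) ⟩
  sum (map f (upTo n ++ n ∷ []))      ≡⟨ cong sum (ListP.map-++ f (upTo n) (n ∷ [])) ⟩
  sum (map f (upTo n) ++ f n ∷ [])    ≡⟨ sum-++ (map f (upTo n)) (f n ∷ []) ⟩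
  sum (map f (upTo n)) + (f n + 0ℚ)   ≡⟨ cong₂ _+_ (sum-map-upTo n f) (+-identityʳ (f n)) ⟩
  ∑ n f + f n                         ∎
  where
  open ≡-Reasoning
  sum-++ : ∀ xs ys → sum (xs ++ ys) ≡ sum xs + sum ys
  sum-++ []       ys = sym (+-identityˡ (sum ys))
  sum-++ (x ∷ xs) ys = trans (cong (λ s → x + s) (sum-++ xs ys)) (sym (+-assoc x (sum xs) (sum ys)))

snoc-built≡map : ∀ (l : ℕ → List ℚ) (a : ℕ → ℚ) → l 0 ≡ [] →
  (∀ n → l (suc n) ≡ l n ++ a n ∷ []) → ∀ n → l n ≡ map a (upTo n)
snoc-built≡map l a l0≡[] step zero    = l0≡[]
snoc-built≡map l a l0≡[] step (suc n) = begin
  l (suc n)                      ≡⟨ step n ⟩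
  l n ++ a n ∷ []                ≡⟨ cong (_++ a n ∷ []) (snoc-built≡map l a l0≡[] step n) ⟩
  map a (upTo n) ++ map a (n ∷ []) ≡⟨ sym (ListP.map-++ a (upTo n) (n ∷ [])) ⟩
  map a (upTo n ++ n ∷ [])       ≡⟨ cong (map a) (ListP.upTo-∷ʳ n) ⟩
  map a (upTo (suc n))           ∎
  where open ≡-Reasoning

sum-zipWith-upTo : ∀ (g : ℕ → ℚ → ℚ) a n → sum (zipWith g (upTo n) (map a (upTo n))) ≡ ∑ n (λ k → g k (a k))
sum-zipWith-upTo g a n = trans (cong sum (zipWith-map-diag (upTo n))) (sum-map-upTo n (λ k → g k (a k)))
  where
  zipWith-map-diag : ∀ xs → zipWith g xs (map a xs) ≡ map (λ k → g k (a k)) xs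
  zipWith-map-diag []       = refl
  zipWith-map-diag (x ∷ xs) = cong (g x (a x) ∷_) (zipWith-map-diag xs)

-- Exponential generating functions

-- A series f stands for the exponential generating function Σ f n tⁿ/n!, so
-- that shift is differentiation and the product is defined by Leibniz' rule.
Series : Set
Series = ℕ → ℚ

shift : Series → Series
shift f n = f (suc n)

infixl 7 _⋆_
infixr 8 _·_
infixl 6 _⊕_ _⊖_

_⋆_ : Series → Series → Series
(f ⋆ g) zero    = f 0 * g 0
(f ⋆ g) (suc n) = (shift f ⋆ g) n + (f ⋆ shift g) n

_⊕_ _⊖_ : Series → Series → Series
(f ⊕ g) n = f n + g n
(f ⊖ g) n = f n - g n

_·_ : ℚ → Series → Series
(c · f) n = c * f n

scale : ℚ → Series → Series
scale c f n = (c ^q n) * f n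

reflect : Series → Series
reflect = scale (- 1ℚ)

X : Series
X zero    = 0ℚ
X (suc n) = δ0 n

exp : Series
exp = const 1ℚ

exp-1 exp+1 : Series
exp-1 = exp ⊖ δ0
exp+1 = exp ⊕ δ0

⋆-cong : ∀ {f f′ g g′} → f ≗ f′ → g ≗ g′ → f ⋆ g ≗ f′ ⋆ g′
⋆-cong f≗f′ g≗g′ zero    = cong₂ _*_ (f≗f′ 0) (g≗g′ 0)
⋆-cong f≗f′ g≗g′ (suc n) = cong₂ _+_ (⋆-cong (f≗f′ ∘ suc) g≗g′ n) (⋆-cong f≗f′ (g≗g′ ∘ suc) n)

⋆-congˡ : ∀ f {g g′} → g ≗ g′ → f ⋆ g ≗ f ⋆ g′
⋆-congˡ f = ⋆-cong (λ _ → refl)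

⋆-congʳ : ∀ g {f f′} → f ≗ f′ → f ⋆ g ≗ f′ ⋆ g
⋆-congʳ g f≗f′ = ⋆-cong f≗f′ (λ _ → refl)

⊕-cong : ∀ {f f′ g g′} → f ≗ f′ → g ≗ g′ → f ⊕ g ≗ f′ ⊕ g′
⊕-cong f≗f′ g≗g′ n = cong₂ _+_ (f≗f′ n) (g≗g′ n)

·-congˡ : ∀ c {f g} → f ≗ g → c · f ≗ c · g
·-congˡ c f≗g n = cong (c *_) (f≗g n)

scale-cong : ∀ c {f g} → f ≗ g → scale c f ≗ scale c g
scale-cong c f≗g n = cong ((c ^q n) *_) (f≗g n)

⋆-comm : ∀ f g → f ⋆ g ≗ g ⋆ f
⋆-comm f g zero    = *-comm (f 0) (g 0)
⋆-comm f g (suc n) = trans (cong₂ _+_ (⋆-comm (shift f) g n) (⋆-comm f (shift g) n))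
                           (+-comm ((g ⋆ shift f) n) ((shift g ⋆ f) n))

⋆-distribʳ-⊕ : ∀ f g h → (f ⊕ g) ⋆ h ≗ f ⋆ h ⊕ g ⋆ h
⋆-distribʳ-⊕ f g h zero    = *-distribʳ-+ (h 0) (f 0) (g 0)
⋆-distribʳ-⊕ f g h (suc n) = trans
  (cong₂ _+_ (⋆-distribʳ-⊕ (shift f) (shift g) h n) (⋆-distribʳ-⊕ f g (shift h) n))
  (solve 4 (λ a b c d → (a :+ b) :+ (c :+ d) := (a :+ c) :+ (b :+ d)) refl
    ((shift f ⋆ h) n) ((shift g ⋆ h) n) ((f ⋆ shift h) n) ((g ⋆ shift h) n))

⋆-distribˡ-⊕ : ∀ f g h → f ⋆ (g ⊕ h) ≗ f ⋆ g ⊕ f ⋆ h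
⋆-distribˡ-⊕ f g h n = trans (⋆-comm f (g ⊕ h) n)
  (trans (⋆-distribʳ-⊕ g h f n) (cong₂ _+_ (⋆-comm g f n) (⋆-comm h f n)))

⋆-distribʳ-⊖ : ∀ f g h → (f ⊖ g) ⋆ h ≗ f ⋆ h ⊖ g ⋆ h
⋆-distribʳ-⊖ f g h zero    = solve 3 (λ a b c → (a :- b) :* c := a :* c :- b :* c) refl (f 0) (g 0) (h 0)
⋆-distribʳ-⊖ f g h (suc n) = trans
  (cong₂ _+_ (⋆-distribʳ-⊖ (shift f) (shift g) h n) (⋆-distribʳ-⊖ f g (shift h) n))
  (solve 4 (λ a b c d → (a :- b) :+ (c :- d) := (a :+ c) :- (b :+ d)) refl
    ((shift f ⋆ h) n) ((shift g ⋆ h) n) ((f ⋆ shift h) n) ((g ⋆ shift h) n))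

·-⋆ : ∀ c f g → c · f ⋆ g ≗ c · (f ⋆ g)
·-⋆ c f g zero    = *-assoc c (f 0) (g 0)
·-⋆ c f g (suc n) = trans (cong₂ _+_ (·-⋆ c (shift f) g n) (·-⋆ c f (shift g) n))
                          (sym (*-distribˡ-+ c _ _))

⋆-· : ∀ c f g → f ⋆ c · g ≗ c · (f ⋆ g)
⋆-· c f g n = trans (⋆-comm f (c · g) n) (trans (·-⋆ c g f n) (cong (c *_) (⋆-comm g f n)))

⋆-zeroˡ : ∀ f → const 0ℚ ⋆ f ≗ const 0ℚ
⋆-zeroˡ f zero    = *-zeroˡ (f 0)
⋆-zeroˡ f (suc n) = cong₂ _+_ (⋆-zeroˡ f n) (⋆-zeroˡ (shift f) n)

⋆-identityˡ : ∀ f → δ0 ⋆ f ≗ f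
⋆-identityˡ f zero    = *-identityˡ (f 0)
⋆-identityˡ f (suc n) = trans (cong₂ _+_ (⋆-zeroˡ f n) (⋆-identityˡ (shift f) n)) (+-identityˡ _)

⋆-identityʳ : ∀ f → f ⋆ δ0 ≗ f
⋆-identityʳ f n = trans (⋆-comm f δ0 n) (⋆-identityˡ f n)

⋆-assoc : ∀ f g h → (f ⋆ g) ⋆ h ≗ f ⋆ (g ⋆ h)
⋆-assoc f g h zero    = *-assoc (f 0) (g 0) (h 0)
⋆-assoc f g h (suc n) = begin
  ((shift f ⋆ g ⊕ f ⋆ shift g) ⋆ h ⊕ (f ⋆ g) ⋆ shift h) n
    ≡⟨ cong (_+ ((f ⋆ g) ⋆ shift h) n) (⋆-distribʳ-⊕ (shift f ⋆ g) (f ⋆ shift g) h n) ⟩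
  (((shift f ⋆ g) ⋆ h ⊕ (f ⋆ shift g) ⋆ h) ⊕ (f ⋆ g) ⋆ shift h) n
    ≡⟨ cong₂ _+_ (cong₂ _+_ (⋆-assoc (shift f) g h n) (⋆-assoc f (shift g) h n)) (⋆-assoc f g (shift h) n) ⟩
  ((shift f ⋆ (g ⋆ h) ⊕ f ⋆ (shift g ⋆ h)) ⊕ f ⋆ (g ⋆ shift h)) n
    ≡⟨ +-assoc ((shift f ⋆ (g ⋆ h)) n) ((f ⋆ (shift g ⋆ h)) n) ((f ⋆ (g ⋆ shift h)) n) ⟩
  (shift f ⋆ (g ⋆ h) ⊕ (f ⋆ (shift g ⋆ h) ⊕ f ⋆ (g ⋆ shift h))) n
    ≡⟨ cong (λ s → (shift f ⋆ (g ⋆ h)) n + s) (sym (⋆-distribˡ-⊕ f (shift g ⋆ h) (g ⋆ shift h) n)) ⟩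
  (shift f ⋆ (g ⋆ h) ⊕ f ⋆ (shift g ⋆ h ⊕ g ⋆ shift h)) n ∎
  where open ≡-Reasoning

scale-⋆ : ∀ c f g → scale c (f ⋆ g) ≗ scale c f ⋆ scale c g
scale-⋆ c f g zero    = trans (*-identityˡ _) (sym (cong₂ _*_ (*-identityˡ (f 0)) (*-identityˡ (g 0))))
scale-⋆ c f g (suc n) = begin
  (c * (c ^q n)) * ((shift f ⋆ g) n + (f ⋆ shift g) n)
    ≡⟨ solve 4 (λ a b x y → (a :* b) :* (x :+ y) := a :* (b :* x) :+ a :* (b :* y)) refl c (c ^q n) _ _ ⟩
  c * scale c (shift f ⋆ g) n + c * scale c (f ⋆ shift g) n
    ≡⟨ cong₂ (λ x y → c * x + c * y) (scale-⋆ c (shift f) g n) (scale-⋆ c f (shift g) n) ⟩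
  c * (scale c (shift f) ⋆ scale c g) n + c * (scale c f ⋆ scale c (shift g)) n
    ≡⟨ cong₂ _+_ (sym (·-⋆ c (scale c (shift f)) (scale c g) n)) (sym (⋆-· c (scale c f) (scale c (shift g)) n)) ⟩
  (c · scale c (shift f) ⋆ scale c g) n + (scale c f ⋆ c · scale c (shift g)) n
    ≡⟨ cong₂ _+_ (⋆-congʳ (scale c g) (λ k → sym (*-assoc c (c ^q k) _)) n)
                 (⋆-congˡ (scale c f) (λ k → sym (*-assoc c (c ^q k) _)) n) ⟩
  (shift (scale c f) ⋆ scale c g) n + (scale c f ⋆ shift (scale c g)) n ∎
  where open ≡-Reasoning

reflect-⋆ : ∀ f m → reflect f ⋆ (reflect m ⋆ exp) ≗ reflect (f ⋆ m) ⋆ exp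
reflect-⋆ f m n = trans (sym (⋆-assoc (reflect f) (reflect m) exp n))
                        (⋆-congʳ exp (λ k → sym (scale-⋆ (- 1ℚ) f m k)) n)

scale-· : ∀ c a f → scale c (a · f) ≗ a · scale c f
scale-· c a f n = solve 3 (λ x a y → x :* (a :* y) := a :* (x :* y)) refl (c ^q n) a (f n)

-1·-1·-identity : ∀ f → (- 1ℚ) · (- 1ℚ) · f ≗ f
-1·-1·-identity f n = solve 1 (λ x → (:- con 1ℚ) :* ((:- con 1ℚ) :* x) := x) refl (f n)

scale-δ0 : ∀ c → scale c δ0 ≗ δ0
scale-δ0 c zero    = *-identityˡ 1ℚ
scale-δ0 c (suc n) = *-zeroʳ (c ^q suc n)

scale-X : ∀ c → scale c X ≗ c · X
scale-X c zero          = trans (*-zeroʳ 1ℚ) (sym (*-zeroʳ c))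
scale-X c (suc zero)    = *-identityʳ (c * 1ℚ)
scale-X c (suc (suc n)) = trans (*-zeroʳ (c ^q suc (suc n))) (sym (*-zeroʳ c))

scale-exp+1 : ∀ c → scale c exp+1 ≗ scale c exp ⊕ δ0
scale-exp+1 c n = trans (*-distribˡ-+ (c ^q n) 1ℚ (δ0 n)) (cong (λ y → (c ^q n) * 1ℚ + y) (scale-δ0 c n))

scale-exp-1 : ∀ c → scale c exp-1 ≗ scale c exp ⊖ δ0
scale-exp-1 c n = trans (solve 3 (λ x a d → x :* (a :- d) := x :* a :- x :* d) refl (c ^q n) 1ℚ (δ0 n))
                        (cong (λ y → (c ^q n) * 1ℚ - y) (scale-δ0 c n))

X-⋆-suc : ∀ f n → (X ⋆ f) (suc n) ≡ ℕ→ℚ (suc n) * f n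
X-⋆-suc f zero    = trans (cong₂ _+_ (*-identityˡ (f 0)) (*-zeroˡ (f 1)))
                          (trans (+-identityʳ (f 0)) (sym (*-identityˡ (f 0))))
X-⋆-suc f (suc n) = begin
  (δ0 ⋆ f) (suc n) + (X ⋆ shift f) (suc n)  ≡⟨ cong₂ _+_ (⋆-identityˡ f (suc n)) (X-⋆-suc (shift f) n) ⟩
  f (suc n) + ℕ→ℚ (suc n) * f (suc n)
    ≡⟨ solve 2 (λ a b → a :+ b :* a := (con 1ℚ :+ b) :* a) refl (f (suc n)) (ℕ→ℚ (suc n)) ⟩
  (1ℚ + ℕ→ℚ (suc n)) * f (suc n)            ≡⟨ cong (_* f (suc n)) (sym (ℕ→ℚ-homo-+ 1 (suc n))) ⟩
  ℕ→ℚ (suc (suc n)) * f (suc n)             ∎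
  where open ≡-Reasoning

X-⋆-cancelˡ : ∀ {f g} → X ⋆ f ≗ X ⋆ g → f ≗ g
X-⋆-cancelˡ {f} {g} eq n = *-cancelˡ-ℕ→ℚ (suc n)
  (trans (sym (X-⋆-suc f n)) (trans (eq (suc n)) (X-⋆-suc g n)))

⋆-cancelʳ-∣X : ∀ {m} u → m ⋆ u ≗ X → ∀ {f g} → f ⋆ m ≗ g ⋆ m → f ≗ g
⋆-cancelʳ-∣X {m} u m⋆u≗X {f} {g} eq = X-⋆-cancelˡ (begin
  X ⋆ f        ≈⟨ ⋆-comm X f ⟩
  f ⋆ X        ≈⟨ ⋆-congˡ f m⋆u≗X ⟨
  f ⋆ (m ⋆ u)  ≈⟨ ⋆-assoc f m u ⟨
  (f ⋆ m) ⋆ u  ≈⟨ ⋆-congʳ u eq ⟩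
  (g ⋆ m) ⋆ u  ≈⟨ ⋆-assoc g m u ⟩
  g ⋆ (m ⋆ u)  ≈⟨ ⋆-congˡ g m⋆u≗X ⟩
  g ⋆ X        ≈⟨ ⋆-comm g X ⟩
  X ⋆ g        ∎)
  where open ≗-Reasoning

binomial : Series → Series
binomial f n = ∑ (suc n) (λ k → ℕ→ℚ (n choose k) * f k)

binomial-pascal : ∀ f n → binomial f (suc n) ≡ binomial (shift f) n + binomial f n
binomial-pascal f n = begin
  ∑ (suc (suc n)) G                              ≡⟨ ∑-split-first (suc n) G ⟩
  G 0 + ∑ (suc n) (G ∘ suc)                      ≡⟨ cong (λ s → G 0 + s) (∑-cong (suc n) pascal) ⟩
  G 0 + ∑ (suc n) (λ k → H k + H′ k)             ≡⟨ cong (λ s → G 0 + s) (∑-distrib-+ (suc n) H H′) ⟩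
  G 0 + (∑ (suc n) H + (∑ n H′ + H′ n))          ≡⟨ cong (λ y → G 0 + (∑ (suc n) H + (∑ n H′ + y))) H′n≡0 ⟩
  G 0 + (∑ (suc n) H + (∑ n H′ + 0ℚ))
    ≡⟨ solve 3 (λ a b c → a :+ (b :+ (c :+ con 0ℚ)) := b :+ (a :+ c)) refl (G 0) (∑ (suc n) H) (∑ n H′) ⟩
  ∑ (suc n) H + (G 0 + ∑ n H′)                  ≡⟨ cong (λ s → ∑ (suc n) H + s) (sym (∑-split-first n (λ k → ℕ→ℚ (n choose k) * f k))) ⟩
  binomial (shift f) n + binomial f n          ∎
  where
  open ≡-Reasoning
  G H H′ : ℕ → ℚ
  G  k = ℕ→ℚ (suc n choose k) * f k
  H  k = ℕ→ℚ (n choose k) * f (suc k)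
  H′ k = ℕ→ℚ (n choose suc k) * f (suc k)
  pascal : ∀ k → G (suc k) ≡ H k + H′ k
  pascal k = begin
    ℕ→ℚ (suc n choose suc k) * f (suc k)
      ≡⟨ cong (λ c → ℕ→ℚ c * f (suc k)) (sym (nCk+nC[k+1]≡[n+1]C[k+1] n k)) ⟩
    ℕ→ℚ (n choose k ℕ.+ n choose suc k) * f (suc k)
      ≡⟨ cong (_* f (suc k)) (ℕ→ℚ-homo-+ (n choose k) (n choose suc k)) ⟩
    (ℕ→ℚ (n choose k) + ℕ→ℚ (n choose suc k)) * f (suc k)
      ≡⟨ *-distribʳ-+ (f (suc k)) (ℕ→ℚ (n choose k)) (ℕ→ℚ (n choose suc k)) ⟩
    H k + H′ k ∎
  H′n≡0 : H′ n ≡ 0ℚ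
  H′n≡0 = trans (cong (λ c → ℕ→ℚ c * f (suc n)) (k>n⇒nCk≡0 (ℕP.n<1+n n))) (*-zeroˡ (f (suc n)))

⋆-exp : ∀ f → f ⋆ exp ≗ binomial f
⋆-exp f zero    = trans (*-identityʳ (f 0)) (trans (sym (*-identityˡ (f 0))) (sym (+-identityˡ _)))
⋆-exp f (suc n) = trans (cong₂ _+_ (⋆-exp (shift f) n) (⋆-exp f n)) (sym (binomial-pascal f n))

⋆-exp+1 : ∀ f → f ⋆ exp+1 ≗ f ⋆ exp ⊕ f
⋆-exp+1 f n = trans (⋆-distribˡ-⊕ f exp δ0 n) (cong (λ y → (f ⋆ exp) n + y) (⋆-identityʳ f n))

⋆-exp-1 : ∀ f → f ⋆ exp-1 ≗ f ⋆ exp ⊖ f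
⋆-exp-1 f n = begin
  (f ⋆ exp-1) n                ≡⟨ ⋆-comm f exp-1 n ⟩
  (exp-1 ⋆ f) n                ≡⟨ ⋆-distribʳ-⊖ exp δ0 f n ⟩
  (exp ⋆ f) n - (δ0 ⋆ f) n     ≡⟨ cong₂ _-_ (⋆-comm exp f n) (⋆-identityˡ f n) ⟩
  (f ⋆ exp) n - f n            ∎
  where open ≡-Reasoning

exp-⋆-exp : exp ⋆ exp ≗ scale (ℕ→ℚ 2) exp
exp-⋆-exp zero    = refl
exp-⋆-exp (suc n) = begin
  (exp ⋆ exp) n + (exp ⋆ exp) n                   ≡⟨ cong₂ _+_ (exp-⋆-exp n) (exp-⋆-exp n) ⟩
  scale (ℕ→ℚ 2) exp n + scale (ℕ→ℚ 2) exp n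
    ≡⟨ solve 1 (λ x → x :+ x := con (ℕ→ℚ 2) :* x) refl (scale (ℕ→ℚ 2) exp n) ⟩
  ℕ→ℚ 2 * ((ℕ→ℚ 2 ^q n) * 1ℚ)                     ≡⟨ sym (*-assoc (ℕ→ℚ 2) (ℕ→ℚ 2 ^q n) 1ℚ) ⟩
  scale (ℕ→ℚ 2) exp (suc n)                       ∎
  where open ≡-Reasoning

reflect-exp-⋆-exp : reflect exp ⋆ exp ≗ δ0
reflect-exp-⋆-exp zero    = refl
reflect-exp-⋆-exp (suc n) = begin
  (shift (reflect exp) ⋆ exp) n + (reflect exp ⋆ exp) n
    ≡⟨ cong (_+ (reflect exp ⋆ exp) n) (⋆-congʳ exp (λ k → *-assoc (- 1ℚ) ((- 1ℚ) ^q k) 1ℚ) n) ⟩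
  ((- 1ℚ) · reflect exp ⋆ exp) n + (reflect exp ⋆ exp) n
    ≡⟨ cong (_+ (reflect exp ⋆ exp) n) (·-⋆ (- 1ℚ) (reflect exp) exp n) ⟩
  - 1ℚ * (reflect exp ⋆ exp) n + (reflect exp ⋆ exp) n
    ≡⟨ solve 1 (λ x → (:- con 1ℚ) :* x :+ x := con 0ℚ) refl ((reflect exp ⋆ exp) n) ⟩
  0ℚ ∎
  where open ≡-Reasoning

reflect-exp+1-⋆-exp : reflect exp+1 ⋆ exp ≗ exp+1
reflect-exp+1-⋆-exp n = begin
  (reflect exp+1 ⋆ exp) n                 ≡⟨ ⋆-congʳ exp (scale-exp+1 (- 1ℚ)) n ⟩
  ((reflect exp ⊕ δ0) ⋆ exp) n            ≡⟨ ⋆-distribʳ-⊕ (reflect exp) δ0 exp n ⟩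
  (reflect exp ⋆ exp) n + (δ0 ⋆ exp) n    ≡⟨ cong₂ _+_ (reflect-exp-⋆-exp n) (⋆-identityˡ exp n) ⟩
  δ0 n + 1ℚ                               ≡⟨ +-comm (δ0 n) 1ℚ ⟩
  exp+1 n                                 ∎
  where open ≡-Reasoning

reflect-exp-1-⋆-exp : (- 1ℚ) · (reflect exp-1 ⋆ exp) ≗ exp-1
reflect-exp-1-⋆-exp n = begin
  - 1ℚ * (reflect exp-1 ⋆ exp) n                   ≡⟨ cong (- 1ℚ *_) (⋆-congʳ exp (scale-exp-1 (- 1ℚ)) n) ⟩
  - 1ℚ * ((reflect exp ⊖ δ0) ⋆ exp) n              ≡⟨ cong (- 1ℚ *_) (⋆-distribʳ-⊖ (reflect exp) δ0 exp n) ⟩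
  - 1ℚ * ((reflect exp ⋆ exp) n - (δ0 ⋆ exp) n)    ≡⟨ cong (λ y → - 1ℚ * y) (cong₂ _-_ (reflect-exp-⋆-exp n) (⋆-identityˡ exp n)) ⟩
  - 1ℚ * (δ0 n - 1ℚ)                               ≡⟨ solve 1 (λ d → (:- con 1ℚ) :* (d :- con 1ℚ) := con 1ℚ :- d) refl (δ0 n) ⟩
  exp-1 n                                          ∎
  where open ≡-Reasoning

exp+1-⋆-exp-1 : exp+1 ⋆ exp-1 ≗ scale (ℕ→ℚ 2) exp-1
exp+1-⋆-exp-1 n = begin
  (exp+1 ⋆ exp-1) n                            ≡⟨ ⋆-exp-1 exp+1 n ⟩
  (exp+1 ⋆ exp) n - exp+1 n                    ≡⟨ cong (_- exp+1 n) (⋆-distribʳ-⊕ exp δ0 exp n) ⟩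
  ((exp ⋆ exp) n + (δ0 ⋆ exp) n) - exp+1 n     ≡⟨ cong (λ y → (y + (δ0 ⋆ exp) n) - exp+1 n) (exp-⋆-exp n) ⟩
  (scale (ℕ→ℚ 2) exp n + (δ0 ⋆ exp) n) - exp+1 n
    ≡⟨ cong (λ y → (scale (ℕ→ℚ 2) exp n + y) - exp+1 n) (⋆-identityˡ exp n) ⟩
  (scale (ℕ→ℚ 2) exp n + 1ℚ) - (1ℚ + δ0 n)
    ≡⟨ solve 2 (λ s d → (s :+ con 1ℚ) :- (con 1ℚ :+ d) := s :- d) refl (scale (ℕ→ℚ 2) exp n) (δ0 n) ⟩
  scale (ℕ→ℚ 2) exp n - δ0 n                   ≡⟨ sym (scale-exp-1 (ℕ→ℚ 2) n) ⟩
  scale (ℕ→ℚ 2) exp-1 n                        ∎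
  where open ≡-Reasoning

-- The Bernoulli and Euler series

euler1 : Series
euler1 n = EulerPoly n 1ℚ

Bern-recurrence : ∀ n → Bern n ≡ (δ0 n - ∑ n (λ k → ℕ→ℚ (suc n choose k) * Bern k)) * inv-suc n
Bern-recurrence n = cong (λ s → (δ0 n - s) * inv-suc n) (begin
  sum (zipWith g (upTo n) (bern-list n))
    ≡⟨ cong (sum ∘ zipWith g (upTo n)) (snoc-built≡map bern-list Bern refl (λ _ → refl) n) ⟩
  sum (zipWith g (upTo n) (map Bern (upTo n)))   ≡⟨ sum-zipWith-upTo g Bern n ⟩
  ∑ n (λ k → g k (Bern k))                       ∎)
  where
  open ≡-Reasoning
  g : ℕ → ℚ → ℚ
  g k b = ℕ→ℚ (suc n choose k) * b

euler1-recurrence : ∀ n → euler1 n ≡ 1ℚ - half * ∑ n (λ k → ℕ→ℚ (n choose k) * euler1 k)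
euler1-recurrence n = cong₂ (λ x s → x - half * s) (1^q n) (begin
  sum (zipWith g (upTo n) (euler-list 1ℚ n))
    ≡⟨ cong (sum ∘ zipWith g (upTo n)) (snoc-built≡map (euler-list 1ℚ) euler1 refl (λ _ → refl) n) ⟩
  sum (zipWith g (upTo n) (map euler1 (upTo n)))   ≡⟨ sum-zipWith-upTo g euler1 n ⟩
  ∑ n (λ k → g k (euler1 k))                       ∎)
  where
  open ≡-Reasoning
  g : ℕ → ℚ → ℚ
  g k e = ℕ→ℚ (n choose k) * e
  1^q : ∀ n → 1ℚ ^q n ≡ 1ℚ
  1^q zero    = refl
  1^q (suc n) = trans (*-identityˡ _) (1^q n)

[1+n]choose[n]≡1+n : ∀ n → suc n choose n ≡ suc n
[1+n]choose[n]≡1+n n = trans (nCk≡nC[n∸k] (ℕP.n≤1+n n)) (trans (cong (suc n choose_) (ℕP.m+n∸n≡m 1 n)) (nC1≡n (suc n)))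

bern-⋆-exp : Bern ⋆ exp ≗ Bern ⊕ X
bern-⋆-exp zero    = refl
bern-⋆-exp (suc n) = begin
  (Bern ⋆ exp) (suc n)                        ≡⟨ ⋆-exp Bern (suc n) ⟩
  (∑ n G + G n) + G (suc n)                   ≡⟨ cong₂ (λ a b → (∑ n G + a) + b) Gn Gsn ⟩
  (∑ n G + (δ0 n - ∑ n G)) + Bern (suc n)
    ≡⟨ solve 3 (λ s d b → (s :+ (d :- s)) :+ b := b :+ d) refl (∑ n G) (δ0 n) (Bern (suc n)) ⟩
  Bern (suc n) + δ0 n                         ∎
  where
  open ≡-Reasoning
  G : ℕ → ℚ
  G k = ℕ→ℚ (suc n choose k) * Bern k
  Gsn : G (suc n) ≡ Bern (suc n)
  Gsn = trans (cong (λ c → ℕ→ℚ c * Bern (suc n)) (nCn≡1 (suc n))) (*-identityˡ _)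
  Gn : G n ≡ δ0 n - ∑ n G
  Gn = begin
    ℕ→ℚ (suc n choose n) * Bern n ≡⟨ cong₂ (λ c b → ℕ→ℚ c * b) ([1+n]choose[n]≡1+n n) (Bern-recurrence n) ⟩
    ℕ→ℚ (suc n) * ((δ0 n - ∑ n G) * inv-suc n)
      ≡⟨ solve 3 (λ a x i → a :* (x :* i) := (a :* i) :* x) refl (ℕ→ℚ (suc n)) (δ0 n - ∑ n G) (inv-suc n) ⟩
    (ℕ→ℚ (suc n) * inv-suc n) * (δ0 n - ∑ n G) ≡⟨ cong (_* (δ0 n - ∑ n G)) (ℕ→ℚ-*-inverse (suc n)) ⟩
    1ℚ * (δ0 n - ∑ n G)                        ≡⟨ *-identityˡ _ ⟩
    δ0 n - ∑ n G                               ∎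

bern-⋆-exp-1 : Bern ⋆ exp-1 ≗ X
bern-⋆-exp-1 n = trans (⋆-exp-1 Bern n) (trans (cong (_- Bern n) (bern-⋆-exp n))
  (solve 2 (λ b x → (b :+ x) :- b := x) refl (Bern n) (X n)))

euler1-⋆-exp+1 : euler1 ⋆ exp+1 ≗ ℕ→ℚ 2 · exp
euler1-⋆-exp+1 n = begin
  (euler1 ⋆ exp+1) n                      ≡⟨ ⋆-distribˡ-⊕ euler1 exp δ0 n ⟩
  (euler1 ⋆ exp) n + (euler1 ⋆ δ0) n      ≡⟨ cong₂ _+_ (⋆-exp euler1 n) (⋆-identityʳ euler1 n) ⟩
  (∑ n H + H n) + euler1 n                ≡⟨ cong (λ y → (∑ n H + y) + euler1 n) Hn ⟩
  (∑ n H + euler1 n) + euler1 n           ≡⟨ cong (λ y → (∑ n H + y) + y) (euler1-recurrence n) ⟩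
  (∑ n H + (1ℚ - half * ∑ n H)) + (1ℚ - half * ∑ n H)
    ≡⟨ solve 1 (λ s → (s :+ (con 1ℚ :- con half :* s)) :+ (con 1ℚ :- con half :* s) := con (ℕ→ℚ 2) :* con 1ℚ) refl (∑ n H) ⟩
  ℕ→ℚ 2 * 1ℚ                              ∎
  where
  open ≡-Reasoning
  H : ℕ → ℚ
  H k = ℕ→ℚ (n choose k) * euler1 k
  Hn : H n ≡ euler1 n
  Hn = trans (cong (λ c → ℕ→ℚ c * euler1 n) (nCn≡1 n)) (*-identityˡ _)

exp-1∣X : exp-1 ⋆ Bern ≗ X
exp-1∣X n = trans (⋆-comm exp-1 Bern n) (bern-⋆-exp-1 n)

exp+1∣X : exp+1 ⋆ half · (euler1 ⋆ reflect exp ⋆ X) ≗ X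
exp+1∣X = begin
  exp+1 ⋆ half · (euler1 ⋆ reflect exp ⋆ X)
    ≈⟨ ⋆-· half exp+1 _ ⟩
  half · (exp+1 ⋆ (euler1 ⋆ reflect exp ⋆ X))
    ≈⟨ ·-congˡ half (⋆-assoc exp+1 (euler1 ⋆ reflect exp) X) ⟨
  half · (exp+1 ⋆ (euler1 ⋆ reflect exp) ⋆ X)
    ≈⟨ ·-congˡ half (⋆-congʳ X (⋆-assoc exp+1 euler1 (reflect exp))) ⟨
  half · (exp+1 ⋆ euler1 ⋆ reflect exp ⋆ X)
    ≈⟨ ·-congˡ half (⋆-congʳ X (⋆-congʳ (reflect exp) (λ n → trans (⋆-comm exp+1 euler1 n) (euler1-⋆-exp+1 n)))) ⟩
  half · (ℕ→ℚ 2 · exp ⋆ reflect exp ⋆ X)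
    ≈⟨ ·-congˡ half (⋆-congʳ X (·-⋆ (ℕ→ℚ 2) exp (reflect exp))) ⟩
  half · (ℕ→ℚ 2 · (exp ⋆ reflect exp) ⋆ X)
    ≈⟨ ·-congˡ half (⋆-congʳ X (·-congˡ (ℕ→ℚ 2) (λ n → trans (⋆-comm exp (reflect exp) n) (reflect-exp-⋆-exp n)))) ⟩
  half · (ℕ→ℚ 2 · δ0 ⋆ X)
    ≈⟨ ·-congˡ half (·-⋆ (ℕ→ℚ 2) δ0 X) ⟩
  half · ℕ→ℚ 2 · (δ0 ⋆ X)
    ≈⟨ ·-congˡ half (·-congˡ (ℕ→ℚ 2) (⋆-identityˡ X)) ⟩
  half · ℕ→ℚ 2 · X
    ≈⟨ (λ n → solve 1 (λ x → con half :* (con (ℕ→ℚ 2) :* x) := x) refl (X n)) ⟩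
  X ∎
  where open ≗-Reasoning

bern⊕X-⋆-exp-1 : (Bern ⊕ X) ⋆ exp-1 ≗ X ⋆ exp
bern⊕X-⋆-exp-1 n = begin
  ((Bern ⊕ X) ⋆ exp-1) n                           ≡⟨ ⋆-exp-1 (Bern ⊕ X) n ⟩
  ((Bern ⊕ X) ⋆ exp) n - (Bern n + X n)            ≡⟨ cong (_- (Bern n + X n)) (⋆-distribʳ-⊕ Bern X exp n) ⟩
  ((Bern ⋆ exp) n + (X ⋆ exp) n) - (Bern n + X n)  ≡⟨ cong (λ y → (y + (X ⋆ exp) n) - (Bern n + X n)) (bern-⋆-exp n) ⟩
  ((Bern n + X n) + (X ⋆ exp) n) - (Bern n + X n)
    ≡⟨ solve 2 (λ b y → (b :+ y) :- b := y) refl (Bern n + X n) ((X ⋆ exp) n) ⟩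
  (X ⋆ exp) n                                      ∎
  where open ≡-Reasoning

reflect-bern : reflect Bern ≗ Bern ⊕ X
reflect-bern = ⋆-cancelʳ-∣X Bern exp-1∣X (begin
  reflect Bern ⋆ exp-1                                 ≈⟨ ⋆-congˡ (reflect Bern) reflect-exp-1-⋆-exp ⟨
  reflect Bern ⋆ (- 1ℚ) · (reflect exp-1 ⋆ exp)        ≈⟨ ⋆-· (- 1ℚ) (reflect Bern) (reflect exp-1 ⋆ exp) ⟩
  (- 1ℚ) · (reflect Bern ⋆ (reflect exp-1 ⋆ exp))      ≈⟨ ·-congˡ (- 1ℚ) (reflect-⋆ Bern exp-1) ⟩
  (- 1ℚ) · (reflect (Bern ⋆ exp-1) ⋆ exp)              ≈⟨ ·-congˡ (- 1ℚ) (⋆-congʳ exp (scale-cong (- 1ℚ) bern-⋆-exp-1)) ⟩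
  (- 1ℚ) · (reflect X ⋆ exp)                           ≈⟨ ·-congˡ (- 1ℚ) (⋆-congʳ exp (scale-X (- 1ℚ))) ⟩
  (- 1ℚ) · ((- 1ℚ) · X ⋆ exp)                          ≈⟨ ·-congˡ (- 1ℚ) (·-⋆ (- 1ℚ) X exp) ⟩
  (- 1ℚ) · (- 1ℚ) · (X ⋆ exp)                          ≈⟨ -1·-1·-identity (X ⋆ exp) ⟩
  X ⋆ exp                                              ≈⟨ bern⊕X-⋆-exp-1 ⟨
  (Bern ⊕ X) ⋆ exp-1                                   ∎)
  where
  open ≗-Reasoning

reflect-euler1 : reflect euler1 ⊕ euler1 ≗ ℕ→ℚ 2 · δ0
reflect-euler1 = ⋆-cancelʳ-∣X _ exp+1∣X (begin
  (reflect euler1 ⊕ euler1) ⋆ exp+1                ≈⟨ ⋆-distribʳ-⊕ (reflect euler1) euler1 exp+1 ⟩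
  reflect euler1 ⋆ exp+1 ⊕ euler1 ⋆ exp+1          ≈⟨ ⊕-cong reflected euler1-⋆-exp+1 ⟩
  ℕ→ℚ 2 · δ0 ⊕ ℕ→ℚ 2 · exp                         ≈⟨ two·δ0⋆exp+1 ⟨
  ℕ→ℚ 2 · δ0 ⋆ exp+1                               ∎)
  where
  open ≗-Reasoning
  reflected : reflect euler1 ⋆ exp+1 ≗ ℕ→ℚ 2 · δ0
  reflected = begin
    reflect euler1 ⋆ exp+1                         ≈⟨ ⋆-congˡ (reflect euler1) reflect-exp+1-⋆-exp ⟨
    reflect euler1 ⋆ (reflect exp+1 ⋆ exp)         ≈⟨ reflect-⋆ euler1 exp+1 ⟩
    reflect (euler1 ⋆ exp+1) ⋆ exp                 ≈⟨ ⋆-congʳ exp (scale-cong (- 1ℚ) euler1-⋆-exp+1) ⟩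
    reflect (ℕ→ℚ 2 · exp) ⋆ exp                    ≈⟨ ⋆-congʳ exp (scale-· (- 1ℚ) (ℕ→ℚ 2) exp) ⟩
    ℕ→ℚ 2 · reflect exp ⋆ exp                      ≈⟨ ·-⋆ (ℕ→ℚ 2) (reflect exp) exp ⟩
    ℕ→ℚ 2 · (reflect exp ⋆ exp)                    ≈⟨ ·-congˡ (ℕ→ℚ 2) reflect-exp-⋆-exp ⟩
    ℕ→ℚ 2 · δ0                                     ∎
  two·δ0⋆exp+1 : ℕ→ℚ 2 · δ0 ⋆ exp+1 ≗ ℕ→ℚ 2 · δ0 ⊕ ℕ→ℚ 2 · exp
  two·δ0⋆exp+1 n = trans (·-⋆ (ℕ→ℚ 2) δ0 exp+1 n) (trans (cong (ℕ→ℚ 2 *_) (⋆-identityˡ exp+1 n))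
    (solve 1 (λ d → con (ℕ→ℚ 2) :* (con 1ℚ :+ d) := con (ℕ→ℚ 2) :* d :+ con (ℕ→ℚ 2) :* con 1ℚ) refl (δ0 n)))

Bern-odd≡0 : ∀ n → Bern (suc (suc (suc (n ℕ.+ n)))) ≡ 0ℚ
Bern-odd≡0 n = x+x≡0⇒x≡0 (begin
  B + B                       ≡⟨ solve 1 (λ b → b :+ b := (b :+ con 0ℚ) :- (:- con 1ℚ) :* b) refl B ⟩
  (B + 0ℚ) - (- 1ℚ) * B       ≡⟨ cong (λ y → (B + 0ℚ) - y * B) (sym -1^k≡-1) ⟩
  (B + 0ℚ) - reflect Bern k   ≡⟨ cong (λ y → (B + 0ℚ) - y) (reflect-bern k) ⟩
  (B + 0ℚ) - (B + 0ℚ)         ≡⟨ +-inverseʳ (B + 0ℚ) ⟩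
  0ℚ                          ∎)
  where
  open ≡-Reasoning
  k = suc (suc (suc (n ℕ.+ n)))
  B = Bern k
  -1^k≡-1 : (- 1ℚ) ^q k ≡ - 1ℚ
  -1^k≡-1 = cong (λ y → (- 1ℚ) * ((- 1ℚ) * ((- 1ℚ) * y))) (-1^[n+n]≡1 n)

euler1-even≡0 : ∀ {n} → 0 ℕ.< n → euler1 (n ℕ.+ n) ≡ 0ℚ
euler1-even≡0 {suc n} _ = x+x≡0⇒x≡0 (begin
  E + E                          ≡⟨ cong (_+ E) (sym (*-identityˡ E)) ⟩
  1ℚ * E + E                     ≡⟨ cong (λ y → y * E + E) (sym (-1^[n+n]≡1 (suc n))) ⟩
  reflect euler1 (suc n ℕ.+ suc n) + E ≡⟨ reflect-euler1 (suc n ℕ.+ suc n) ⟩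
  ℕ→ℚ 2 * 0ℚ                     ≡⟨ *-zeroʳ (ℕ→ℚ 2) ⟩
  0ℚ                             ∎)
  where
  open ≡-Reasoning
  E = euler1 (suc n ℕ.+ suc n)

bern-duplication : scale (ℕ→ℚ 2) Bern ⋆ exp+1 ≗ ℕ→ℚ 2 · Bern
bern-duplication = ⋆-cancelʳ-∣X Bern exp-1∣X (begin
  scale (ℕ→ℚ 2) Bern ⋆ exp+1 ⋆ exp-1       ≈⟨ ⋆-assoc (scale (ℕ→ℚ 2) Bern) exp+1 exp-1 ⟩
  scale (ℕ→ℚ 2) Bern ⋆ (exp+1 ⋆ exp-1)     ≈⟨ ⋆-congˡ (scale (ℕ→ℚ 2) Bern) exp+1-⋆-exp-1 ⟩
  scale (ℕ→ℚ 2) Bern ⋆ scale (ℕ→ℚ 2) exp-1 ≈⟨ scale-⋆ (ℕ→ℚ 2) Bern exp-1 ⟨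
  scale (ℕ→ℚ 2) (Bern ⋆ exp-1)             ≈⟨ scale-cong (ℕ→ℚ 2) bern-⋆-exp-1 ⟩
  scale (ℕ→ℚ 2) X                          ≈⟨ scale-X (ℕ→ℚ 2) ⟩
  ℕ→ℚ 2 · X                                ≈⟨ ·-congˡ (ℕ→ℚ 2) bern-⋆-exp-1 ⟨
  ℕ→ℚ 2 · (Bern ⋆ exp-1)                   ≈⟨ ·-⋆ (ℕ→ℚ 2) Bern exp-1 ⟨
  ℕ→ℚ 2 · Bern ⋆ exp-1                     ∎)
  where open ≗-Reasoning

bern-difference-⋆-exp+1 : (scale (ℕ→ℚ 2) Bern ⊖ Bern ⊕ X) ⋆ exp+1 ≗ X ⋆ exp
bern-difference-⋆-exp+1 n = begin
  ((scale (ℕ→ℚ 2) Bern ⊖ Bern ⊕ X) ⋆ exp+1) n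
    ≡⟨ ⋆-distribʳ-⊕ (scale (ℕ→ℚ 2) Bern ⊖ Bern) X exp+1 n ⟩
  ((scale (ℕ→ℚ 2) Bern ⊖ Bern) ⋆ exp+1) n + (X ⋆ exp+1) n
    ≡⟨ cong (_+ (X ⋆ exp+1) n) (⋆-distribʳ-⊖ (scale (ℕ→ℚ 2) Bern) Bern exp+1 n) ⟩
  ((scale (ℕ→ℚ 2) Bern ⋆ exp+1) n - (Bern ⋆ exp+1) n) + (X ⋆ exp+1) n
    ≡⟨ cong₂ (λ d b → (d - b) + (X ⋆ exp+1) n) (bern-duplication n) (⋆-exp+1 Bern n) ⟩
  (ℕ→ℚ 2 * Bern n - ((Bern ⋆ exp) n + Bern n)) + (X ⋆ exp+1) n
    ≡⟨ cong₂ (λ b x → (ℕ→ℚ 2 * Bern n - (b + Bern n)) + x) (bern-⋆-exp n) (⋆-exp+1 X n) ⟩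
  (ℕ→ℚ 2 * Bern n - ((Bern n + X n) + Bern n)) + ((X ⋆ exp) n + X n)
    ≡⟨ solve 3 (λ b x y → (con (ℕ→ℚ 2) :* b :- ((b :+ x) :+ b)) :+ (y :+ x) := y) refl (Bern n) (X n) ((X ⋆ exp) n) ⟩
  (X ⋆ exp) n ∎
  where open ≡-Reasoning

euler1-duplication : X ⋆ euler1 ≗ ℕ→ℚ 2 · (scale (ℕ→ℚ 2) Bern ⊖ Bern ⊕ X)
euler1-duplication = ⋆-cancelʳ-∣X _ exp+1∣X (begin
  X ⋆ euler1 ⋆ exp+1                                   ≈⟨ ⋆-assoc X euler1 exp+1 ⟩
  X ⋆ (euler1 ⋆ exp+1)                                 ≈⟨ ⋆-congˡ X euler1-⋆-exp+1 ⟩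
  X ⋆ ℕ→ℚ 2 · exp                                      ≈⟨ ⋆-· (ℕ→ℚ 2) X exp ⟩
  ℕ→ℚ 2 · (X ⋆ exp)                                    ≈⟨ ·-congˡ (ℕ→ℚ 2) bern-difference-⋆-exp+1 ⟨
  ℕ→ℚ 2 · ((scale (ℕ→ℚ 2) Bern ⊖ Bern ⊕ X) ⋆ exp+1)    ≈⟨ ·-⋆ (ℕ→ℚ 2) _ exp+1 ⟨
  ℕ→ℚ 2 · (scale (ℕ→ℚ 2) Bern ⊖ Bern ⊕ X) ⋆ exp+1      ∎)
  where
  open ≗-Reasoning

-- The coefficients C_n

C-term-euler≡0 : ∀ n k → euler1 (n ℕ.∸ k) ≡ 0ℚ → C-term n k ≡ 0ℚ
C-term-euler≡0 n k = zero-factor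
  where
  zero-factor : ∀ {x y z} → x ≡ 0ℚ → (x * y) * z ≡ 0ℚ
  zero-factor {y = y} {z} refl = trans (cong (_* z) (*-zeroˡ y)) (*-zeroˡ z)

C-term-bern≡0 : ∀ n k → Bmod k ≡ 0ℚ → C-term n k ≡ 0ℚ
C-term-bern≡0 n k = zero-factor {w = euler1 (n ℕ.∸ k) * ((+ 1) / ((n ℕ.∸ k) ℕ.!)) {{(n ℕ.∸ k) ℕP.!≢0}}}
  where
  zero-factor : ∀ {w x y z} → x ≡ 0ℚ → w * ((x * y) * z) ≡ 0ℚ
  zero-factor {w} {y = y} {z} refl =
    trans (cong (λ v → w * (v * z)) (*-zeroˡ y)) (trans (cong (w *_) (*-zeroˡ z)) (*-zeroʳ w))

[m+m]∸[n+n]≡[m∸n]+[m∸n] : ∀ m n → (m ℕ.+ m) ℕ.∸ (n ℕ.+ n) ≡ (m ℕ.∸ n) ℕ.+ (m ℕ.∸ n)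
[m+m]∸[n+n]≡[m∸n]+[m∸n] m       zero    = refl
[m+m]∸[n+n]≡[m∸n]+[m∸n] zero    (suc n) = refl
[m+m]∸[n+n]≡[m∸n]+[m∸n] (suc m) (suc n) rewrite ℕP.+-suc m m | ℕP.+-suc n n = [m+m]∸[n+n]≡[m∸n]+[m∸n] m n

C-terms-middle≡0 : ∀ m → ∑ (m ℕ.+ m) (λ i → C-term (suc (suc (m ℕ.+ m))) (suc (suc i))) ≡ 0ℚ
C-terms-middle≡0 m = trans (∑-pairs m _) (∑-zero m _ (λ l l<m → trans
  (cong₂ _+_ (C-term-euler≡0 N (suc (suc (l ℕ.+ l))) (even l l<m))
             (C-term-bern≡0 N (suc (suc (suc (l ℕ.+ l)))) (Bern-odd≡0 l)))
  (+-identityʳ 0ℚ)))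
  where
  N = suc (suc (m ℕ.+ m))
  even : ∀ l → l ℕ.< m → euler1 ((m ℕ.+ m) ℕ.∸ (l ℕ.+ l)) ≡ 0ℚ
  even l l<m = trans (cong euler1 ([m+m]∸[n+n]≡[m∸n]+[m∸n] m l)) (euler1-even≡0 (ℕP.m<n⇒0<n∸m l<m))

C-term-first : ∀ n → ℕ→ℚ (suc n ℕ.!) * C-term (suc n) 1 ≡ half * (ℕ→ℚ (suc n) * euler1 n)
C-term-first n = begin
  ℕ→ℚ (suc n ℕ.!) * ((euler1 n * 1/n!) * ((half * 1ℚ) * 1ℚ))
    ≡⟨ cong (_* ((euler1 n * 1/n!) * ((half * 1ℚ) * 1ℚ))) (ℕ→ℚ-homo-* (suc n) (n ℕ.!)) ⟩
  (ℕ→ℚ (suc n) * ℕ→ℚ (n ℕ.!)) * ((euler1 n * 1/n!) * ((half * 1ℚ) * 1ℚ))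
    ≡⟨ solve 5 (λ a f e i h → (a :* f) :* ((e :* i) :* ((h :* con 1ℚ) :* con 1ℚ)) := h :* (a :* e) :* (f :* i))
         refl (ℕ→ℚ (suc n)) (ℕ→ℚ (n ℕ.!)) (euler1 n) 1/n! half ⟩
  half * (ℕ→ℚ (suc n) * euler1 n) * (ℕ→ℚ (n ℕ.!) * 1/n!)
    ≡⟨ cong (half * (ℕ→ℚ (suc n) * euler1 n) *_) (ℕ→ℚ-*-inverse (n ℕ.!) {{n ℕP.!≢0}}) ⟩
  half * (ℕ→ℚ (suc n) * euler1 n) * 1ℚ
    ≡⟨ *-identityʳ _ ⟩
  half * (ℕ→ℚ (suc n) * euler1 n) ∎
  where
  open ≡-Reasoning
  1/n! = ((+ 1) / (n ℕ.!)) {{n ℕP.!≢0}}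

C-term-last : ∀ n →
  ℕ→ℚ (suc (suc n) ℕ.!) * C-term (suc (suc n)) (suc (suc n)) ≡ Bern (suc (suc n)) * inv-suc (suc n)
C-term-last n = begin
  ℕ→ℚ (N ℕ.!) * ((euler1 (n ℕ.∸ n) * 1/[n∸n]!) * ((Bern N * 1/N!) * inv-suc (suc n)))
    ≡⟨ cong (λ y → ℕ→ℚ (N ℕ.!) * (y * ((Bern N * 1/N!) * inv-suc (suc n)))) (E₀/0!≡1 (ℕP.n∸n≡0 n)) ⟩
  ℕ→ℚ (N ℕ.!) * (1ℚ * ((Bern N * 1/N!) * inv-suc (suc n)))
    ≡⟨ solve 4 (λ f b i j → f :* (con 1ℚ :* ((b :* i) :* j)) := (b :* j) :* (f :* i))
         refl (ℕ→ℚ (N ℕ.!)) (Bern N) 1/N! (inv-suc (suc n)) ⟩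
  (Bern N * inv-suc (suc n)) * (ℕ→ℚ (N ℕ.!) * 1/N!)
    ≡⟨ cong ((Bern N * inv-suc (suc n)) *_) (ℕ→ℚ-*-inverse (N ℕ.!) {{N ℕP.!≢0}}) ⟩
  (Bern N * inv-suc (suc n)) * 1ℚ
    ≡⟨ *-identityʳ _ ⟩
  Bern N * inv-suc (suc n) ∎
  where
  open ≡-Reasoning
  N = suc (suc n)
  1/N! = ((+ 1) / (N ℕ.!)) {{N ℕP.!≢0}}
  1/[n∸n]! = ((+ 1) / ((n ℕ.∸ n) ℕ.!)) {{(n ℕ.∸ n) ℕP.!≢0}}
  E₀/0!≡1 : ∀ {q} → q ≡ 0 → euler1 q * ((+ 1) / (q ℕ.!)) {{q ℕP.!≢0}} ≡ 1ℚ
  E₀/0!≡1 refl = refl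

factorial-C-even : ∀ m → let N = suc (suc (m ℕ.+ m)) in
  ℕ→ℚ (N ℕ.!) * C N ≡ half * (half * (ℕ→ℚ N * euler1 (suc (m ℕ.+ m))) + Bern N * inv-suc (suc (m ℕ.+ m)))
factorial-C-even m = begin
  ℕ→ℚ (N ℕ.!) * (half * sum (map F (upTo N)))
    ≡⟨ cong (λ s → ℕ→ℚ (N ℕ.!) * (half * s)) (sum-map-upTo N F) ⟩
  ℕ→ℚ (N ℕ.!) * (half * (∑ (suc p) F + F (suc p)))
    ≡⟨ cong (λ s → ℕ→ℚ (N ℕ.!) * (half * (s + F (suc p)))) (∑-split-first p F) ⟩
  ℕ→ℚ (N ℕ.!) * (half * ((F 0 + ∑ p (F ∘ suc)) + F (suc p)))
    ≡⟨ cong (λ s → ℕ→ℚ (N ℕ.!) * (half * ((F 0 + s) + F (suc p)))) (C-terms-middle≡0 m) ⟩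
  ℕ→ℚ (N ℕ.!) * (half * ((F 0 + 0ℚ) + F (suc p)))
    ≡⟨ solve 4 (λ f h a b → f :* (h :* ((a :+ con 0ℚ) :+ b)) := h :* (f :* a :+ f :* b)) refl (ℕ→ℚ (N ℕ.!)) half (F 0) (F (suc p)) ⟩
  half * (ℕ→ℚ (N ℕ.!) * F 0 + ℕ→ℚ (N ℕ.!) * F (suc p))
    ≡⟨ cong₂ (λ a b → half * (a + b)) (C-term-first (suc p)) (C-term-last p) ⟩
  half * (half * (ℕ→ℚ N * euler1 (suc p)) + Bern N * inv-suc (suc p)) ∎
  where
  open ≡-Reasoning
  p = m ℕ.+ m
  N = suc (suc p)
  F : ℕ → ℚ
  F i = C-term N (suc i)

C-even-closed-form : ∀ m → let p = m ℕ.+ m; N = suc (suc p) in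
  ℕ→ℚ (N ℕ.!) * C N ≡ ((half * inv-suc (suc p) + ℕ→ℚ 2 ^q suc p) - half) * Bern N
C-even-closed-form m = begin
  ℕ→ℚ (N ℕ.!) * C N
    ≡⟨ factorial-C-even m ⟩
  half * (half * (ℕ→ℚ N * euler1 (suc p)) + B * i)
    ≡⟨ cong (λ y → half * (half * y + B * i)) (trans (sym (X-⋆-suc euler1 (suc p))) (euler1-duplication N)) ⟩
  half * (half * (ℕ→ℚ 2 * ((ℕ→ℚ 2 * t * B - B) + 0ℚ)) + B * i)
    ≡⟨ solve 3 (λ t b i → con half :* (con half :* (two :* ((two :* t :* b :- b) :+ con 0ℚ)) :+ b :* i)
                        := ((con half :* i :+ t) :- con half) :* b) refl t B i ⟩
  ((half * i + t) - half) * B ∎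
  where
  open ≡-Reasoning
  p = m ℕ.+ m
  N = suc (suc p)
  B = Bern N
  i = inv-suc (suc p)
  t = ℕ→ℚ 2 ^q suc p
  two = con (ℕ→ℚ 2)

2*[1+m]≡2+[m+m] : ∀ m → 2 ℕ.* suc m ≡ suc (suc (m ℕ.+ m))
2*[1+m]≡2+[m+m] m = cong suc (trans (cong (m ℕ.+_) (cong suc (ℕP.+-identityʳ m))) (ℕP.+-suc m m))

corollary1 : (m : ℕ) →
    ℕ→ℚ ((2 ℕ.* suc m) ℕ.!) * C (2 ℕ.* suc m)
      ≡ (((+ 1) / (4 ℕ.* suc m) + ℕ→ℚ (2 ℕ.^ (2 ℕ.* suc m ℕ.∸ 1))) - half)
          * Bern (2 ℕ.* suc m)
corollary1 m = begin
  ℕ→ℚ (N′ ℕ.!) * C N′                                  ≡⟨ cong (λ n → ℕ→ℚ (n ℕ.!) * C n) N′≡N ⟩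
  ℕ→ℚ (N ℕ.!) * C N                                    ≡⟨ C-even-closed-form m ⟩
  ((half * inv-suc (suc p) + ℕ→ℚ 2 ^q suc p) - half) * Bern N
    ≡⟨ cong₂ (λ x y → ((x + y) - half) * Bern N) (sym 1/[4[1+m]]) (sym 2^[N′∸1]) ⟩
  (((+ 1) / (4 ℕ.* suc m) + ℕ→ℚ (2 ℕ.^ (N′ ℕ.∸ 1))) - half) * Bern N
    ≡⟨ cong (λ n → (((+ 1) / (4 ℕ.* suc m) + ℕ→ℚ (2 ℕ.^ (N′ ℕ.∸ 1))) - half) * Bern n) (sym N′≡N) ⟩
  (((+ 1) / (4 ℕ.* suc m) + ℕ→ℚ (2 ℕ.^ (N′ ℕ.∸ 1))) - half) * Bern N′ ∎
  where
  open ≡-Reasoning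
  N′ = 2 ℕ.* suc m
  p = m ℕ.+ m
  N = suc (suc p)
  N′≡N : N′ ≡ N
  N′≡N = 2*[1+m]≡2+[m+m] m
  1/[4[1+m]] : (+ 1) / (4 ℕ.* suc m) ≡ half * inv-suc (suc p)
  1/[4[1+m]] = 1/[2*[1+n]]≡½*1/[1+n] (suc p) (4 ℕ.* suc m) (trans (ℕP.*-assoc 2 2 (suc m)) (cong (2 ℕ.*_) N′≡N))
  2^[N′∸1] : ℕ→ℚ (2 ℕ.^ (N′ ℕ.∸ 1)) ≡ ℕ→ℚ 2 ^q suc p
  2^[N′∸1] = trans (cong (λ n → ℕ→ℚ (2 ℕ.^ (n ℕ.∸ 1))) N′≡N) (ℕ→ℚ-homo-^ 2 (suc p))
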